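{- Assume small set quotients exist. Let \(\mathcal V\) be a univalent universe. Then the ordinal \(\mathrm{Ord}_{\mathcal V}\) of ordinals in \(\mathcal V\) has suprema of families indexed by types in \(\mathcal V\): for every \(I:\mathcal V\) and \(\alpha:I\to\mathrm{Ord}_{\mathcal V}\) there is \(\hat\alpha:\mathrm{Ord}_{\mathcal V}\) with \(\alpha_i\preceq\hat\alpha\) for all \(i\), and \(\hat\alpha\preceq\beta\) for every \(\beta:\mathrm{Ord}_{\mathcal V}\) with \(\alpha_i\preceq\beta\) for all \(i:I\).
   Context: Work in univalent foundations (intensional Martin-Löf type theory with universes, function and propositional extensionality, propositional truncations in each universe). An ordinal is a type with a proposition-valued, transitive, extensional and (inductively) well-founded relation \(\prec\). \(\mathrm{Ord}_{\mathcal V}\) is the type of ordinals whose carrier is in \(\mathcal V\). For \(y:\beta\), \(\beta\downarrow y\) is the ordinal of elements \(b\prec y\). A simulation \(f:\alpha\to\beta\) is a map preserving \(\prec\) such that whenever \(y\prec f(x)\) there is \(x'\prec x\) with \(f(x')=y\). Write \(\alpha\preceq\beta\) if there is a simulation \(\alpha\to\beta\) (equivalently, every ordinal \(\gamma\) with \(\gamma\prec\alpha\) satisfies \(\gamma\prec\beta\), where \(\gamma\prec\alpha\) means there is \(a:\alpha\) with \(\gamma\) isomorphic to \(\alpha\downarrow a\)). Small set quotients exist: for every type \(X:\mathcal U\) and every proposition-valued equivalence relation \(\approx\) on \(X\) with values in \(\mathcal V\), there is \(X/{\approx}:\mathcal U\sqcup\mathcal V\) and \(\eta:X\to X/{\approx}\)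 respecting \(\approx\), satisfying the universal property (unique factorization of \(\approx\)-respecting maps into sets of any universe) and the induction principle for proposition-valued families in any universe. -}

{-# OPTIONS --without-K #-}
module Defs where

open import Level using (Level; _⊔_; suc; Setω)
open import Data.Product using (Σ; Σ-syntax; _×_; _,_; proj₁; proj₂)
open import Relation.Binary.PropositionalEquality using (_≡_; refl)
open import Induction.WellFounded using (WellFounded)
open import Function using (id; _∘_)

isContr : ∀ {ℓ} → Set ℓ → Set ℓ
isContr A = Σ[ c ∈ A ] ((x : A) → c ≡ x)

isProp : ∀ {ℓ} → Set ℓ → Set ℓ
isProp A = (x y : A) → x ≡ y

isSet : ∀ {ℓ} → Set ℓ → Set ℓ
isSet A = (x y : A) → isProp (x ≡ y)

fiber : ∀ {a b} {A : Set a} {B : Set b} → (A → B) → B → Set (a ⊔ b)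
fiber {A = A} f y = Σ[ x ∈ A ] (f x ≡ y)

isEquiv : ∀ {a b} {A : Set a} {B : Set b} → (A → B) → Set (a ⊔ b)
isEquiv {B = B} f = (y : B) → isContr (fiber f y)

_≃_ : ∀ {a b} → Set a → Set b → Set (a ⊔ b)
A ≃ B = Σ (A → B) isEquiv

id-isEquiv : ∀ {a} {A : Set a} → isEquiv (id {A = A})
id-isEquiv y = (y , refl) , λ { (x , refl) → refl }

idtoeqv : ∀ {a} {A B : Set a} → A ≡ B → A ≃ B
idtoeqv refl = id , id-isEquiv

isUnivalent : (𝓥 : Level) → Set (suc 𝓥)
isUnivalent 𝓥 = (A B : Set 𝓥) → isEquiv (idtoeqv {A = A} {B = B})

FunExt : Setω
FunExt = ∀ {a b} {A : Set a} {B : A → Set b} {f g : (x : A) → B x}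
         → ((x : A) → f x ≡ g x) → f ≡ g

PropExt : Setω
PropExt = ∀ {ℓ} {P Q : Set ℓ} → isProp P → isProp Q → (P → Q) → (Q → P) → P ≡ Q

record PropTrunc : Setω where
  field
    ∥_∥       : ∀ {ℓ} → Set ℓ → Set ℓ
    ∥∥-isProp : ∀ {ℓ} {A : Set ℓ} → isProp ∥ A ∥
    ∣_∣       : ∀ {ℓ} {A : Set ℓ} → A → ∥ A ∥
    ∥∥-rec    : ∀ {ℓ ℓ'} {A : Set ℓ} {P : Set ℓ'} → isProp P → (A → P) → ∥ A ∥ → P

record IsPropEquivRel {𝓤 𝓥 : Level} {X : Set 𝓤} (_≈_ : X → X → Set 𝓥) : Set (𝓤 ⊔ 𝓥) where
  field
    ≈-isProp : (x y : X) → isProp (x ≈ y)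
    ≈-refl   : (x : X) → x ≈ x
    ≈-sym    : (x y : X) → x ≈ y → y ≈ x
    ≈-trans  : (x y z : X) → x ≈ y → y ≈ z → x ≈ z

record SmallSetQuotients : Setω where
  field
    _/_ : ∀ {𝓤 𝓥} (X : Set 𝓤) (_≈_ : X → X → Set 𝓥) → Set (𝓤 ⊔ 𝓥)
    η/  : ∀ {𝓤 𝓥} {X : Set 𝓤} {_≈_ : X → X → Set 𝓥} → IsPropEquivRel _≈_
          → X → X / _≈_
    η/-respects : ∀ {𝓤 𝓥} {X : Set 𝓤} {_≈_ : X → X → Set 𝓥}
          (e : IsPropEquivRel _≈_) (x y : X) → x ≈ y → η/ e x ≡ η/ e y
    /-isSet : ∀ {𝓤 𝓥} {X : Set 𝓤} {_≈_ : X → X → Set 𝓥}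
          → IsPropEquivRel _≈_ → isSet (X / _≈_)
    /-universal : ∀ {𝓤 𝓥 𝓦} {X : Set 𝓤} {_≈_ : X → X → Set 𝓥}
          (e : IsPropEquivRel _≈_) (A : Set 𝓦) → isSet A
          → (f : X → A) → ((x y : X) → x ≈ y → f x ≡ f y)
          → isContr (Σ[ g ∈ (X / _≈_ → A) ] (g ∘ η/ e ≡ f))
    /-induction : ∀ {𝓤 𝓥 𝓦} {X : Set 𝓤} {_≈_ : X → X → Set 𝓥}
          (e : IsPropEquivRel _≈_) (P : X / _≈_ → Set 𝓦)
          → ((q : X / _≈_) → isProp (P q))
          → ((x : X) → P (η/ e x)) → (q : X / _≈_) → P q

record Ordinal (𝓥 : Level) : Set (suc 𝓥) where
  field
    Carrier    : Set 𝓥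
    _≺_        : Carrier → Carrier → Set 𝓥
    ≺-isProp   : (x y : Carrier) → isProp (x ≺ y)
    ≺-trans    : (x y z : Carrier) → x ≺ y → y ≺ z → x ≺ z
    ≺-extensional : (x y : Carrier)
                 → ((z : Carrier) → z ≺ x → z ≺ y)
                 → ((z : Carrier) → z ≺ y → z ≺ x)
                 → x ≡ y
    ≺-wellFounded : WellFounded _≺_

open Ordinal public using (Carrier)

isSimulation : ∀ {𝓥} (α β : Ordinal 𝓥) → (Carrier α → Carrier β) → Set 𝓥
isSimulation α β f =
    ((x y : Carrier α) → x ≺α y → f x ≺β f y)
  × ((x : Carrier α) (y : Carrier β) → y ≺β f x
       → Σ[ x' ∈ Carrier α ] (x' ≺α x × f x' ≡ y))
  where
    open Ordinal α using () renaming (_≺_ to _≺α_)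
    open Ordinal β using () renaming (_≺_ to _≺β_)

_⪯_ : ∀ {𝓥} → Ordinal 𝓥 → Ordinal 𝓥 → Set 𝓥
α ⪯ β = Σ[ f ∈ (Carrier α → Carrier β) ] isSimulation α β f

{-# OPTIONS --safe --without-K #-}
-- The supremum is the image of (i , x) ↦ α i ↓ x, built as the quotient of Σ I (Carrier ∘ α)
-- by mutual simulability of these initial segments and ordered by "is an initial segment of".
-- Each α i embeds by x ↦ ⟦ i , x ⟧. For an upper bound β with simulations f i, the segment
-- α i ↓ x is equivalent to β ↓ f i x, and segments of β determine their endpoints; hence
-- (i , x) ↦ f i x is well defined and injective on the quotient, and is a simulation α̂ ⪯ β.
module Submission where

open import Defs
open import Level using (Level) renaming (suc to lsuc)
open import Data.Product using (Σ; Σ-syntax; _×_; _,_; proj₁; proj₂)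
open import Relation.Binary.PropositionalEquality
  using (_≡_; refl; sym; trans; cong; cong₂; subst; subst₂; module ≡-Reasoning)
open import Induction.WellFounded
  using (WellFounded; Acc; acc; Acc-resp-≈; module All)
import Relation.Binary.Construct.On as On
open import Axiom.UniquenessOfIdentityProofs using (module Constant⇒UIP)
open import Function using (_∘_; _on_)
open import Data.Unit using (⊤; tt)

private variable
  a b ℓ 𝓥 : Level
  A : Set a

Σ-≡-prop : {B : A → Set b} → ((x : A) → isProp (B x))
  → {x x' : A} {u : B x} {u' : B x'} → x ≡ x' → (x , u) ≡ (x' , u')
Σ-≡-prop B-isProp {x} {u = u} {u'} refl = cong (x ,_) (B-isProp x u u')

Σ-isProp : {B : A → Set b} → ((x : A) → isProp (B x))
  → ((u v : Σ A B) → proj₁ u ≡ proj₁ v) → isProp (Σ A B)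
Σ-isProp B-isProp proj₁-equal u v = Σ-≡-prop B-isProp (proj₁-equal u v)

×-isProp : {B : Set b} → isProp A → isProp B → isProp (A × B)
×-isProp A-isProp B-isProp (x , y) (x' , y') = cong₂ _,_ (A-isProp x x') (B-isProp y y')

propRel⇒isSet : (R : A → A → Set ℓ) → (∀ x y → isProp (R x y))
  → (∀ x → R x x) → (∀ {x y} → R x y → x ≡ y) → isSet A
propRel⇒isSet R R-isProp R-refl R⇒≡ _ _ = Constant⇒UIP.≡-irrelevant normalise normalise-constant
  where
  normalise : ∀ {x y} → x ≡ y → x ≡ y
  normalise {x} x≡y = R⇒≡ (subst (R x) x≡y (R-refl x))
  normalise-constant : ∀ {x y} (p q : x ≡ y) → normalise p ≡ normalise q
  normalise-constant p q = cong R⇒≡ (R-isProp _ _ _ _)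

isProp⇒isSet : isProp A → isSet A
isProp⇒isSet A-isProp =
  propRel⇒isSet (λ _ _ → ⊤) (λ _ _ _ _ → refl) (λ _ → tt) (λ {x} {y} _ → A-isProp x y)

Ω : (ℓ : Level) → Set (lsuc ℓ)
Ω ℓ = Σ (Set ℓ) isProp

private variable
  α β γ δ : Ordinal 𝓥

infix 4 [_]_≺_
infixl 30 _↓_

[_]_≺_ : (α : Ordinal 𝓥) → Carrier α → Carrier α → Set 𝓥
[ α ] x ≺ y = Ordinal._≺_ α x y

_↓_ : (α : Ordinal 𝓥) → Carrier α → Ordinal 𝓥
α ↓ a = record
  { Carrier = Σ[ x ∈ Carrier α ] (x ≺ a)
  ; _≺_ = _≺_ on proj₁
  ; ≺-isProp = λ u v → ≺-isProp (proj₁ u) (proj₁ v)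
  ; ≺-trans = λ u v w → ≺-trans (proj₁ u) (proj₁ v) (proj₁ w)
  ; ≺-extensional = λ u v u≼v v≼u → Σ-≡-prop (λ x → ≺-isProp x a)
      (≺-extensional (proj₁ u) (proj₁ v)
        (λ z z≺u → u≼v (z , ≺-trans z _ a z≺u (proj₂ u)) z≺u)
        (λ z z≺v → v≼u (z , ≺-trans z _ a z≺v (proj₂ v)) z≺v))
  ; ≺-wellFounded = On.wellFounded proj₁ ≺-wellFounded
  }
  where open Ordinal α using (_≺_; ≺-isProp; ≺-trans; ≺-extensional; ≺-wellFounded)

↓-incl : (α : Ordinal 𝓥) (a : Carrier α) → α ↓ a ⪯ α
↓-incl α a = proj₁ , (λ _ _ u≺v → u≺v) ,
  λ (x , x≺a) y y≺x → (y , Ordinal.≺-trans α y x a y≺x x≺a) , y≺x , refl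

⪯-refl : (α : Ordinal 𝓥) → α ⪯ α
⪯-refl α = (λ x → x) , (λ _ _ x≺y → x≺y) , λ _ y y≺x → y , y≺x , refl

⪯-trans : (α β γ : Ordinal 𝓥) → α ⪯ β → β ⪯ γ → α ⪯ γ
⪯-trans _ _ _ (f , f-mono , f-sim) (g , g-mono , g-sim) =
  g ∘ f , (λ x y x≺y → g-mono (f x) (f y) (f-mono x y x≺y)) ,
  λ x z z≺gfx → let (y , y≺fx , gy≡z) = g-sim (f x) z z≺gfx
                    (x' , x'≺x , fx'≡y) = f-sim x y y≺fx
                in x' , x'≺x , trans (cong g fx'≡y) gy≡z

⪯-unique : (α β : Ordinal 𝓥) (f g : α ⪯ β) (x : Carrier α) → proj₁ f x ≡ proj₁ g x
⪯-unique α β f g = All.wfRec (Ordinal.≺-wellFounded α) _ _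
  λ x agree → Ordinal.≺-extensional β _ _
    (≼-if-agree-below f g x agree) (≼-if-agree-below g f x (sym ∘ agree))
  where
  ≼-if-agree-below : (f g : α ⪯ β) (x : Carrier α)
    → (∀ {x'} → [ α ] x' ≺ x → proj₁ f x' ≡ proj₁ g x')
    → ∀ z → [ β ] z ≺ proj₁ f x → [ β ] z ≺ proj₁ g x
  ≼-if-agree-below (f , _ , f-sim) (g , g-mono , _) x agree z z≺fx
    with f-sim x z z≺fx
  ... | x' , x'≺x , refl = subst (λ t → [ β ] t ≺ g x) (sym (agree x'≺x)) (g-mono x' x x'≺x)

⪯-injective : (α β : Ordinal 𝓥) (f : α ⪯ β) {x y : Carrier α} → proj₁ f x ≡ proj₁ f y → x ≡ y
⪯-injective α β (f , f-mono , f-sim) {x} {y} =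
  All.wfRec (Ordinal.≺-wellFounded α) _ (λ x → ∀ y → f x ≡ f y → x ≡ y) step x y
  where
  step : ∀ x → (∀ {x'} → [ α ] x' ≺ x → ∀ y → f x' ≡ f y → x' ≡ y)
    → ∀ y → f x ≡ f y → x ≡ y
  step x ih y fx≡fy = Ordinal.≺-extensional α x y below-x below-y
    where
    below-x : ∀ z → [ α ] z ≺ x → [ α ] z ≺ y
    below-x z z≺x with f-sim y (f z) (subst ([ β ] f z ≺_) fx≡fy (f-mono z x z≺x))
    ... | w , w≺y , fw≡fz = subst ([ α ]_≺ y) (sym (ih z≺x w (sym fw≡fz))) w≺y
    below-y : ∀ w → [ α ] w ≺ y → [ α ] w ≺ x
    below-y w w≺y with f-sim x (f w) (subst ([ β ] f w ≺_) (sym fx≡fy) (f-mono w y w≺y))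
    ... | z , z≺x , fz≡fw = subst ([ α ]_≺ x) (ih z≺x w fz≡fw) z≺x

⪯-reflects-≺ : (α β : Ordinal 𝓥) (f : α ⪯ β) {x y : Carrier α}
  → [ β ] proj₁ f x ≺ proj₁ f y → [ α ] x ≺ y
⪯-reflects-≺ α β f {x} {y} fx≺fy with proj₂ (proj₂ f) y (proj₁ f x) fx≺fy
... | z , z≺y , fz≡fx = subst ([ α ]_≺ y) (⪯-injective α β f fz≡fx) z≺y

below-fiber-isProp : (α : Ordinal 𝓥) {B : Set b} (f : Carrier α → B) → isSet B
  → (∀ {x y} → f x ≡ f y → x ≡ y) → (x : Carrier α) (y : B)
  → isProp (Σ[ x' ∈ Carrier α ] ([ α ] x' ≺ x × f x' ≡ y))
below-fiber-isProp α f B-isSet f-injective x y =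
  Σ-isProp (λ x' → ×-isProp (Ordinal.≺-isProp α x' x) (B-isSet _ _))
    λ (_ , _ , fx'≡y) (_ , _ , fx''≡y) → f-injective (trans fx'≡y (sym fx''≡y))

infix 4 _≈ₒ_ _⊲_

-- Mutual simulability replaces equality of ordinals. Unlike through _⪯_ (a Σ-type), the
-- ordinals are inferable through these records; lemmas on _⪯_ take them explicitly.

record _≈ₒ_ (α β : Ordinal 𝓥) : Set 𝓥 where
  constructor _,_
  field
    to   : α ⪯ β
    from : β ⪯ α

open _≈ₒ_

≈ₒ-refl : α ≈ₒ α
≈ₒ-refl {α = α} = ⪯-refl α , ⪯-refl α

≈ₒ-sym : α ≈ₒ β → β ≈ₒ α
≈ₒ-sym (f , g) = g , f

≈ₒ-trans : α ≈ₒ β → β ≈ₒ γ → α ≈ₒ γ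
≈ₒ-trans {α = α} {β = β} {γ = γ} (f , f⁻) (g , g⁻) = ⪯-trans α β γ f g , ⪯-trans γ β α g⁻ f⁻

↓-⪯-↓ : (α β : Ordinal 𝓥) (f : α ⪯ β) (a : Carrier α) → α ↓ a ⪯ β ↓ proj₁ f a
↓-⪯-↓ α β (f , f-mono , f-sim) a = g , (λ u v → f-mono (proj₁ u) (proj₁ v)) , g-sim
  where
  g : Carrier (α ↓ a) → Carrier (β ↓ f a)
  g (x , x≺a) = f x , f-mono x a x≺a
  g-sim : (u : Carrier (α ↓ a)) (v : Carrier (β ↓ f a)) → [ β ↓ f a ] v ≺ g u
    → Σ[ u' ∈ Carrier (α ↓ a) ] ([ α ↓ a ] u' ≺ u × g u' ≡ v)
  g-sim (x , x≺a) (y , _) y≺fx with f-sim x y y≺fx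
  ... | x' , x'≺x , refl = (x' , Ordinal.≺-trans α x' x a x'≺x x≺a) , x'≺x ,
    Σ-≡-prop (λ z → Ordinal.≺-isProp β z (f a)) refl

↓-⪰-↓ : (α β : Ordinal 𝓥) (f : α ⪯ β) (a : Carrier α) → β ↓ proj₁ f a ⪯ α ↓ a
↓-⪰-↓ α β f@(f' , f-mono , f-sim) a = g , g-mono , g-sim
  where
  g : Carrier (β ↓ f' a) → Carrier (α ↓ a)
  g (y , y≺fa) = let (x , x≺a , _) = f-sim a y y≺fa in x , x≺a
  f∘g : (v : Carrier (β ↓ f' a)) → f' (proj₁ (g v)) ≡ proj₁ v
  f∘g (y , y≺fa) = proj₂ (proj₂ (f-sim a y y≺fa))
  g-mono : (u v : Carrier (β ↓ f' a)) → [ β ↓ f' a ] u ≺ v → [ α ↓ a ] g u ≺ g v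
  g-mono u v u≺v = ⪯-reflects-≺ α β f (subst₂ (Ordinal._≺_ β) (sym (f∘g u)) (sym (f∘g v)) u≺v)
  g-sim : (v : Carrier (β ↓ f' a)) (u : Carrier (α ↓ a)) → [ α ↓ a ] u ≺ g v
    → Σ[ v' ∈ Carrier (β ↓ f' a) ] ([ β ↓ f' a ] v' ≺ v × g v' ≡ u)
  g-sim v (x , x≺a) x≺gv = fx , subst ([ β ] f' x ≺_) (f∘g v) (f-mono x _ x≺gv) ,
    Σ-≡-prop (λ z → Ordinal.≺-isProp α z a) (⪯-injective α β f (f∘g fx))
    where
    fx : Carrier (β ↓ f' a)
    fx = f' x , f-mono x a x≺a

↓-≈ₒ : (α β : Ordinal 𝓥) (f : α ⪯ β) (a : Carrier α) → α ↓ a ≈ₒ β ↓ proj₁ f a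
↓-≈ₒ α β f a = ↓-⪯-↓ α β f a , ↓-⪰-↓ α β f a

↓-↓ : (α : Ordinal 𝓥) (a : Carrier α) (u : Carrier (α ↓ a)) → α ↓ a ↓ u ≈ₒ α ↓ proj₁ u
↓-↓ α a = ↓-≈ₒ (α ↓ a) α (↓-incl α a)

↓-⪯⇒≼ : (α : Ordinal 𝓥) {a b : Carrier α} → α ↓ a ⪯ α ↓ b
  → ∀ c → [ α ] c ≺ a → [ α ] c ≺ b
↓-⪯⇒≼ α {a} {b} g c c≺a =
  subst ([ α ]_≺ b) (⪯-unique (α ↓ a) α g↓ (↓-incl α a) (c , c≺a)) (proj₂ (proj₁ g (c , c≺a)))
  where
  g↓ : α ↓ a ⪯ α
  g↓ = ⪯-trans (α ↓ a) (α ↓ b) α g (↓-incl α b)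

↓-injective : (α : Ordinal 𝓥) {a b : Carrier α} → α ↓ a ≈ₒ α ↓ b → a ≡ b
↓-injective α (f , g) = Ordinal.≺-extensional α _ _ (↓-⪯⇒≼ α f) (↓-⪯⇒≼ α g)

record _⊲_ (γ α : Ordinal 𝓥) : Set 𝓥 where
  constructor _,_
  field
    point : Carrier α
    ≈ₒ-↓  : γ ≈ₒ α ↓ point

⊲⇒⪯ : γ ⊲ α → γ ⪯ α
⊲⇒⪯ {γ = γ} {α = α} (a , (f , _)) = ⪯-trans γ (α ↓ a) α f (↓-incl α a)

⊲-⪯-trans : γ ⊲ α → α ⪯ β → γ ⊲ β
⊲-⪯-trans {α = α} {β = β} (a , e) f = proj₁ f a , ≈ₒ-trans e (↓-≈ₒ α β f a)

⊲-respects-≈ₒ : α ≈ₒ β → γ ⊲ α → γ ⊲ β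
⊲-respects-≈ₒ e γ⊲α = ⊲-⪯-trans γ⊲α (to e)

≈ₒ-⊲-trans : γ ≈ₒ δ → δ ⊲ α → γ ⊲ α
≈ₒ-⊲-trans e (a , e') = a , ≈ₒ-trans e e'

⊲-trans : γ ⊲ δ → δ ⊲ α → γ ⊲ α
⊲-trans γ⊲δ δ⊲α = ⊲-⪯-trans γ⊲δ (⊲⇒⪯ δ⊲α)

⊲-↓ : (α : Ordinal 𝓥) {a : Carrier α} → γ ⊲ α ↓ a
  → Σ[ c ∈ Carrier α ] ([ α ] c ≺ a × γ ≈ₒ α ↓ c)
⊲-↓ α {a} (u , e) = proj₁ u , proj₂ u , ≈ₒ-trans e (↓-↓ α a u)

↓-⊲-↓ : (α : Ordinal 𝓥) {a c : Carrier α} → [ α ] c ≺ a → α ↓ c ⊲ α ↓ a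
↓-⊲-↓ α {a} c≺a = (_ , c≺a) , ≈ₒ-sym (↓-↓ α a (_ , c≺a))

↓-⊲-↓⁻¹ : (α : Ordinal 𝓥) {a c : Carrier α} → α ↓ c ⊲ α ↓ a → [ α ] c ≺ a
↓-⊲-↓⁻¹ α {a} ↓c⊲↓a with ⊲-↓ α ↓c⊲↓a
... | c' , c'≺a , ↓c≈↓c' = subst ([ α ]_≺ a) (sym (↓-injective α ↓c≈↓c')) c'≺a

↓-⊲⇒⪯ : (α β : Ordinal 𝓥) → ((a : Carrier α) → α ↓ a ⊲ β) → α ⪯ β
↓-⊲⇒⪯ α β ↓-⊲β = f , f-mono , f-sim
  where
  f : Carrier α → Carrier β
  f a = _⊲_.point (↓-⊲β a)
  ↓≈↓f : (a : Carrier α) → α ↓ a ≈ₒ β ↓ f a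
  ↓≈↓f a = _⊲_.≈ₒ-↓ (↓-⊲β a)
  f-mono : (a a' : Carrier α) → [ α ] a ≺ a' → [ β ] f a ≺ f a'
  f-mono a a' a≺a' = ↓-⊲-↓⁻¹ β
    (≈ₒ-⊲-trans (≈ₒ-sym (↓≈↓f a)) (⊲-⪯-trans (↓-⊲-↓ α a≺a') (to (↓≈↓f a'))))
  f-sim : (a : Carrier α) (b : Carrier β) → [ β ] b ≺ f a
    → Σ[ a' ∈ Carrier α ] ([ α ] a' ≺ a × f a' ≡ b)
  f-sim a b b≺fa with ⊲-↓ α (⊲-⪯-trans (↓-⊲-↓ β b≺fa) (from (↓≈↓f a)))
  ... | a' , a'≺a , ↓b≈↓a' = a' , a'≺a , sym (↓-injective β (≈ₒ-trans ↓b≈↓a' (↓≈↓f a')))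

Acc-⊲-respects-≈ₒ : α ≈ₒ β → Acc _⊲_ β → Acc _⊲_ α
Acc-⊲-respects-≈ₒ α≈β = Acc-resp-≈ ≈ₒ-sym ⊲-respects-≈ₒ (≈ₒ-sym α≈β)

⊲-wellFounded : WellFounded (_⊲_ {𝓥})
⊲-wellFounded α = acc λ (a , γ≈↓a) → Acc-⊲-respects-≈ₒ γ≈↓a (↓-accessible a)
  where
  ↓-accessible : (a : Carrier α) → Acc _⊲_ (α ↓ a)
  ↓-accessible = All.wfRec (Ordinal.≺-wellFounded α) _ (λ a → Acc _⊲_ (α ↓ a))
    λ a ih → acc λ γ⊲↓a → let (c , c≺a , γ≈↓c) = ⊲-↓ α γ⊲↓a in Acc-⊲-respects-≈ₒ γ≈↓c (ih c≺a)

module Extensional (fe : FunExt) where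

  Π-isProp : {B : A → Set b} → ((x : A) → isProp (B x)) → isProp ((x : A) → B x)
  Π-isProp B-isProp f g = fe λ x → B-isProp x (f x) (g x)

  isProp-isProp : isProp (isProp A)
  isProp-isProp A-isProp A-isProp' = fe λ x → fe λ y → isProp⇒isSet A-isProp x y _ _

  Acc-isProp : {_<_ : A → A → Set ℓ} {x : A} → isProp (Acc _<_ x)
  Acc-isProp {_<_ = _<_} {x} (acc rs) (acc rs') =
    cong (λ (r : ∀ y → y < x → Acc _<_ y) → acc λ {y} → r y)
      (fe λ y → fe λ y<x → Acc-isProp (rs y<x) (rs' y<x))

  Carrier-isSet : (α : Ordinal 𝓥) → isSet (Carrier α)
  Carrier-isSet α = propRel⇒isSet same-predecessors
    (λ x y → ×-isProp (≼-isProp x y) (≼-isProp y x))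
    (λ _ → (λ _ z≺x → z≺x) , (λ _ z≺x → z≺x))
    (λ (x≼y , y≼x) → ≺-extensional _ _ x≼y y≼x)
    where
    open Ordinal α using (_≺_; ≺-isProp; ≺-extensional)
    _≼_ : Carrier α → Carrier α → Set _
    x ≼ y = ∀ z → z ≺ x → z ≺ y
    ≼-isProp : ∀ x y → isProp (x ≼ y)
    ≼-isProp x y = Π-isProp λ z → Π-isProp λ _ → ≺-isProp z y
    same-predecessors : Carrier α → Carrier α → Set _
    same-predecessors x y = x ≼ y × y ≼ x

  ⪯-isProp : (α β : Ordinal 𝓥) → isProp (α ⪯ β)
  ⪯-isProp α β f@(f' , _) g with fe (⪯-unique α β f g)
  ... | refl = cong (f' ,_) (×-isProp
    (Π-isProp λ x → Π-isProp λ y → Π-isProp λ _ → Ordinal.≺-isProp β (f' x) (f' y))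
    (Π-isProp λ x → Π-isProp λ y → Π-isProp λ _ →
      below-fiber-isProp α f' (Carrier-isSet β) (⪯-injective α β f) x y) _ _)

  ≈ₒ-isProp : isProp (α ≈ₒ β)
  ≈ₒ-isProp {α = α} {β = β} (f , g) (f' , g') = cong₂ _,_ (⪯-isProp α β f f') (⪯-isProp β α g g')

  ⊲-isProp : isProp (γ ⊲ α)
  ⊲-isProp {α = α} (a , e) (a' , e') with ↓-injective α (≈ₒ-trans (≈ₒ-sym e) e')
  ... | refl = cong (a ,_) (≈ₒ-isProp e e')

  Ω-isSet : PropExt → isSet (Ω ℓ)
  Ω-isSet pe = propRel⇒isSet (λ P Q → (proj₁ P → proj₁ Q) × (proj₁ Q → proj₁ P))
    (λ P Q → ×-isProp (Π-isProp λ _ → proj₂ Q) (Π-isProp λ _ → proj₂ P))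
    (λ _ → (λ p → p) , (λ p → p))
    (λ {P} {Q} (P→Q , Q→P) → Σ-≡-prop (λ _ → isProp-isProp) (pe (proj₂ P) (proj₂ Q) P→Q Q→P))

  /-effective : PropExt → (sq : SmallSetQuotients) {X : Set a} {_≈_ : X → X → Set ℓ}
    (e : IsPropEquivRel _≈_) {x y : X}
    → SmallSetQuotients.η/ sq e x ≡ SmallSetQuotients.η/ sq e y → x ≈ y
  /-effective pe sq {X = X} {_≈_} e {x} {y} ηx≡ηy = subst proj₁ x≈x≡x≈y (≈-refl x)
    where
    open SmallSetQuotients sq using (_/_; η/; /-universal)
    open IsPropEquivRel e
    x≈ : X → Ω _
    x≈ z = (x ≈ z) , ≈-isProp x z
    x≈-respects : (z z' : X) → z ≈ z' → x≈ z ≡ x≈ z'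
    x≈-respects z z' z≈z' = Σ-≡-prop (λ _ → isProp-isProp) (pe (≈-isProp x z) (≈-isProp x z')
      (λ x≈z → ≈-trans x z z' x≈z z≈z') (λ x≈z' → ≈-trans x z' z x≈z' (≈-sym z z' z≈z')))
    lifted : Σ[ g ∈ (X / _≈_ → Ω _) ] (g ∘ η/ e ≡ x≈)
    lifted = proj₁ (/-universal e (Ω _) (Ω-isSet pe) x≈ x≈-respects)
    lift-η : ∀ z → proj₁ lifted (η/ e z) ≡ x≈ z
    lift-η z = cong (λ h → h z) (proj₂ lifted)
    x≈x≡x≈y : x≈ x ≡ x≈ y
    x≈x≡x≈y = begin
      x≈ x                   ≡⟨ sym (lift-η x) ⟩
      proj₁ lifted (η/ e x)  ≡⟨ cong (proj₁ lifted) ηx≡ηy ⟩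
      proj₁ lifted (η/ e y)  ≡⟨ lift-η y ⟩
      x≈ y                   ∎
      where open ≡-Reasoning

module Supremum (fe : FunExt) (pe : PropExt) (pt : PropTrunc) (sq : SmallSetQuotients)
  {𝓥 : Level} {I : Set 𝓥} (α : I → Ordinal 𝓥) where
  open Extensional fe
  open PropTrunc pt
  open SmallSetQuotients sq

  X : Set 𝓥
  X = Σ I (Carrier ∘ α)

  S : X → Ordinal 𝓥
  S (i , x) = α i ↓ x

  _≈_ : X → X → Set 𝓥
  p ≈ p' = S p ≈ₒ S p'

  ≈-isPropEquivRel : IsPropEquivRel _≈_
  ≈-isPropEquivRel = record
    { ≈-isProp = λ _ _ → ≈ₒ-isProp
    ; ≈-refl   = λ _ → ≈ₒ-refl
    ; ≈-sym    = λ _ _ → ≈ₒ-sym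
    ; ≈-trans  = λ _ _ _ → ≈ₒ-trans
    }

  Q : Set 𝓥
  Q = X / _≈_

  ⟦_⟧ : X → Q
  ⟦_⟧ = η/ ≈-isPropEquivRel

  Q-isSet : isSet Q
  Q-isSet = /-isSet ≈-isPropEquivRel

  Q-ind : {P : Q → Set ℓ} → (∀ q → isProp (P q)) → (∀ p → P ⟦ p ⟧) → ∀ q → P q
  Q-ind = /-induction ≈-isPropEquivRel _

  ⟦⟧-respects : {p p' : X} → p ≈ p' → ⟦ p ⟧ ≡ ⟦ p' ⟧
  ⟦⟧-respects = η/-respects ≈-isPropEquivRel _ _

  ⟦⟧-effective : {p p' : X} → ⟦ p ⟧ ≡ ⟦ p' ⟧ → p ≈ p'
  ⟦⟧-effective = /-effective pe sq ≈-isPropEquivRel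

  _≺_ : Q → Q → Set 𝓥
  q ≺ q' = ∥ Σ[ p ∈ X ] Σ[ p' ∈ X ] (⟦ p ⟧ ≡ q × ⟦ p' ⟧ ≡ q' × S p ⊲ S p') ∥

  ⊲⇒≺ : {p p' : X} → S p ⊲ S p' → ⟦ p ⟧ ≺ ⟦ p' ⟧
  ⊲⇒≺ Sp⊲Sp' = ∣ _ , _ , refl , refl , Sp⊲Sp' ∣

  ≺⇒⊲ : {p p' : X} → ⟦ p ⟧ ≺ ⟦ p' ⟧ → S p ⊲ S p'
  ≺⇒⊲ = ∥∥-rec ⊲-isProp λ (r , r' , ⟦r⟧≡⟦p⟧ , ⟦r'⟧≡⟦p'⟧ , Sr⊲Sr') →
    ≈ₒ-⊲-trans (⟦⟧-effective (sym ⟦r⟧≡⟦p⟧)) (⊲-respects-≈ₒ (⟦⟧-effective ⟦r'⟧≡⟦p'⟧) Sr⊲Sr')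

  ≺-trans : (q q' q'' : Q) → q ≺ q' → q' ≺ q'' → q ≺ q''
  ≺-trans = Q-ind (λ _ → Π-isProp λ _ → Π-isProp λ _ → Π-isProp λ _ → Π-isProp λ _ → ∥∥-isProp)
    λ p → Q-ind (λ _ → Π-isProp λ _ → Π-isProp λ _ → Π-isProp λ _ → ∥∥-isProp)
    λ p' → Q-ind (λ _ → Π-isProp λ _ → Π-isProp λ _ → ∥∥-isProp)
    λ p'' p≺p' p'≺p'' → ⊲⇒≺ (⊲-trans (≺⇒⊲ p≺p') (≺⇒⊲ p'≺p''))

  ⪯-if-below : (p p' : X) → (∀ r → S r ⊲ S p → S r ⊲ S p') → S p ⪯ S p'
  ⪯-if-below (i , x) p' below = ↓-⊲⇒⪯ (S (i , x)) (S p') λ u →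
    ≈ₒ-⊲-trans (↓-↓ (α i) x u) (below (i , proj₁ u) (↓-⊲-↓ (α i) (proj₂ u)))

  ≺-extensional : (q q' : Q) → (∀ z → z ≺ q → z ≺ q') → (∀ z → z ≺ q' → z ≺ q) → q ≡ q'
  ≺-extensional = Q-ind (λ q → Π-isProp λ q' → Π-isProp λ _ → Π-isProp λ _ → Q-isSet q q')
    λ p → Q-ind (λ q' → Π-isProp λ _ → Π-isProp λ _ → Q-isSet ⟦ p ⟧ q')
    λ p' p≼p' p'≼p → ⟦⟧-respects
      ( ⪯-if-below p p' (λ r → ≺⇒⊲ ∘ p≼p' ⟦ r ⟧ ∘ ⊲⇒≺)
      , ⪯-if-below p' p (λ r → ≺⇒⊲ ∘ p'≼p ⟦ r ⟧ ∘ ⊲⇒≺))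

  ⟦⟧-accessible : (p : X) → Acc _⊲_ (S p) → Acc _≺_ ⟦ p ⟧
  ⟦⟧-accessible p (acc rs) = acc λ {q} → Q-ind {P = λ q → q ≺ ⟦ p ⟧ → Acc _≺_ q}
    (λ _ → Π-isProp λ _ → Acc-isProp) (λ r r≺p → ⟦⟧-accessible r (rs (≺⇒⊲ r≺p))) q

  ≺-wellFounded : WellFounded _≺_
  ≺-wellFounded = Q-ind (λ _ → Acc-isProp) λ p → ⟦⟧-accessible p (⊲-wellFounded (S p))

  α̂ : Ordinal 𝓥
  α̂ = record
    { Carrier = Q
    ; _≺_ = _≺_
    ; ≺-isProp = λ _ _ → ∥∥-isProp
    ; ≺-trans = ≺-trans
    ; ≺-extensional = ≺-extensional
    ; ≺-wellFounded = ≺-wellFounded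
    }

  α-⪯-α̂ : (i : I) → α i ⪯ α̂
  α-⪯-α̂ i = ι , (λ x y x≺y → ⊲⇒≺ (↓-⊲-↓ (α i) x≺y)) , ι-sim
    where
    ι : Carrier (α i) → Q
    ι x = ⟦ i , x ⟧
    ι-sim : (x : Carrier (α i)) (q : Q) → q ≺ ι x
      → Σ[ x' ∈ Carrier (α i) ] ([ α i ] x' ≺ x × ι x' ≡ q)
    ι-sim x = Q-ind (λ q → Π-isProp λ _ → below-fiber-isProp (α i) ι Q-isSet
        (λ ιx≡ιy → ↓-injective (α i) (⟦⟧-effective ιx≡ιy)) x q)
      λ r r≺ιx → let (c , c≺x , Sr≈↓c) = ⊲-↓ (α i) (≺⇒⊲ r≺ιx)
                 in c , c≺x , ⟦⟧-respects (≈ₒ-sym Sr≈↓c)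

  module _ (β : Ordinal 𝓥) (α-⪯-β : (i : I) → α i ⪯ β) where

    φ : X → Carrier β
    φ (i , x) = proj₁ (α-⪯-β i) x

    S≈↓φ : (p : X) → S p ≈ₒ β ↓ φ p
    S≈↓φ (i , x) = ↓-≈ₒ (α i) β (α-⪯-β i) x

    φ-respects : (p p' : X) → p ≈ p' → φ p ≡ φ p'
    φ-respects p p' p≈p' = ↓-injective β (≈ₒ-trans (≈ₒ-sym (S≈↓φ p)) (≈ₒ-trans p≈p' (S≈↓φ p')))

    φ-reflects : (p p' : X) → φ p ≡ φ p' → p ≈ p'
    φ-reflects p p' φp≡φp' =
      ≈ₒ-trans (S≈↓φ p) (subst (λ b → β ↓ b ≈ₒ S p') (sym φp≡φp') (≈ₒ-sym (S≈↓φ p')))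

    lifted : Σ[ F ∈ (Q → Carrier β) ] (F ∘ ⟦_⟧ ≡ φ)
    lifted = proj₁ (/-universal ≈-isPropEquivRel (Carrier β) (Carrier-isSet β) φ φ-respects)

    F : Q → Carrier β
    F = proj₁ lifted

    F-⟦⟧ : (p : X) → F ⟦ p ⟧ ≡ φ p
    F-⟦⟧ p = cong (λ h → h p) (proj₂ lifted)

    F-injective : (q q' : Q) → F q ≡ F q' → q ≡ q'
    F-injective = Q-ind (λ q → Π-isProp λ q' → Π-isProp λ _ → Q-isSet q q')
      λ p → Q-ind (λ q' → Π-isProp λ _ → Q-isSet ⟦ p ⟧ q')
      λ p' Fp≡Fp' → ⟦⟧-respects (φ-reflects p p' (trans (sym (F-⟦⟧ p)) (trans Fp≡Fp' (F-⟦⟧ p'))))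

    F-mono : (q q' : Q) → q ≺ q' → [ β ] F q ≺ F q'
    F-mono = Q-ind (λ q → Π-isProp λ q' → Π-isProp λ _ → Ordinal.≺-isProp β (F q) (F q'))
      λ p → Q-ind (λ q' → Π-isProp λ _ → Ordinal.≺-isProp β (F ⟦ p ⟧) (F q'))
      λ p' p≺p' → subst₂ (Ordinal._≺_ β) (sym (F-⟦⟧ p)) (sym (F-⟦⟧ p')) (↓-⊲-↓⁻¹ β
        (≈ₒ-⊲-trans (≈ₒ-sym (S≈↓φ p)) (⊲-respects-≈ₒ (S≈↓φ p') (≺⇒⊲ p≺p'))))

    F-sim : (q : Q) (b : Carrier β) → [ β ] b ≺ F q → Σ[ q' ∈ Q ] (q' ≺ q × F q' ≡ b)
    F-sim = Q-ind (λ q → Π-isProp λ b → Π-isProp λ _ →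
        below-fiber-isProp α̂ F (Carrier-isSet β) (F-injective _ _) q b)
      λ (i , x) b b≺Fp →
        let (x' , x'≺x , φx'≡b) =
              proj₂ (proj₂ (α-⪯-β i)) x b (subst ([ β ] b ≺_) (F-⟦⟧ (i , x)) b≺Fp)
        in ⟦ i , x' ⟧ , ⊲⇒≺ (↓-⊲-↓ (α i) x'≺x) , trans (F-⟦⟧ (i , x')) φx'≡b

    α̂-⪯-β : α̂ ⪯ β
    α̂-⪯-β = F , F-mono , F-sim

theorem5p12 : FunExt → PropExt → PropTrunc → SmallSetQuotients
    → (𝓥 : Level) → isUnivalent 𝓥
    → (I : Set 𝓥) (α : I → Ordinal 𝓥)
    → Σ[ α̂ ∈ Ordinal 𝓥 ] (((i : I) → α i ⪯ α̂)
        × ((β : Ordinal 𝓥) → ((i : I) → α i ⪯ β) → α̂ ⪯ β))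
theorem5p12 fe pe pt sq 𝓥 _ I α = α̂ , α-⪯-α̂ , α̂-⪯-β
  where open Supremum fe pe pt sq α
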